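{- Let $n\ge 1$ and let $\mathcal{P}(n,1,1)$ denote the set of lattice paths with steps $(1,1)$ (up) and $(1,-1)$ (down) from $(0,0)$ to $(2n+1,1)$. Then: (1) for each $k=1,2,\dots,n+1$, the number of paths in $\mathcal{P}(n,1,1)$ that start with an up step and have exactly $k$ up steps starting on or below the $x$-axis is $\frac{1}{n+1}\binom{2n}{n}$; (2) for each $k=1,2,\dots,n$, the number of paths in $\mathcal{P}(n,1,1)$ that start with a down step and have exactly $k$ down steps starting on or below the $x$-axis is $\frac{1}{n}\binom{2n}{n-1}$; (3) for each $k=1,2,\dots,2n+1$, the number of paths in $\mathcal{P}(n,1,1)$ with exactly $k$ vertices on or below the $x$-axis is $\frac{1}{2n+1}\binom{2n+1}{n}$.
   Context: A step "starts on or below the $x$-axis" if its initial vertex has $y$-coordinate $\le 0$. The vertices of a path are $P_0=(0,0),P_1,\dots$, the successive endpoints of its steps. -}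

module Defs where

open import Data.Bool using (Bool; true; false; if_then_else_; _∧_)
open import Data.Nat as ℕ using (ℕ; zero; suc)
open import Data.Integer as ℤ using (ℤ; +_; _≤ᵇ_; 0ℤ; 1ℤ; -1ℤ)
open import Relation.Nullary using (does)
open import Data.List using (List; []; _∷_; [_]; _++_; map)

-- A lattice path is encoded as the list of its steps:
-- true = up step (1,1), false = down step (1,-1).

allLists : ℕ → List (List Bool)
allLists zero = [ [] ]
allLists (suc m) = map (true ∷_) (allLists m) ++ map (false ∷_) (allLists m)

stepℤ : Bool → ℤ
stepℤ true = 1ℤ
stepℤ false = -1ℤ

endHeight : ℤ → List Bool → ℤ
endHeight h [] = h
endHeight h (b ∷ bs) = endHeight (h ℤ.+ stepℤ b) bs

-- membership in P(n,1,1): a path of length 2n+1 (guaranteed by allLists)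
-- from (0,0) ending at height 1
endsAtOne : List Bool → Bool
endsAtOne p = does (endHeight 0ℤ p ℤ.≟ 1ℤ)

startsUp : List Bool → Bool
startsUp (true ∷ _) = true
startsUp _ = false

startsDown : List Bool → Bool
startsDown (false ∷ _) = true
startsDown _ = false

ind : Bool → ℕ
ind true = 1
ind false = 0

upsLow : ℤ → List Bool → ℕ
upsLow h [] = 0
upsLow h (true ∷ bs) = ind (h ≤ᵇ 0ℤ) ℕ.+ upsLow (h ℤ.+ 1ℤ) bs
upsLow h (false ∷ bs) = upsLow (h ℤ.+ -1ℤ) bs

downsLow : ℤ → List Bool → ℕ
downsLow h [] = 0
downsLow h (true ∷ bs) = downsLow (h ℤ.+ 1ℤ) bs
downsLow h (false ∷ bs) = ind (h ≤ᵇ 0ℤ) ℕ.+ downsLow (h ℤ.+ -1ℤ) bs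

vertsLow : ℤ → List Bool → ℕ
vertsLow h [] = ind (h ≤ᵇ 0ℤ)
vertsLow h (b ∷ bs) = ind (h ≤ᵇ 0ℤ) ℕ.+ vertsLow (h ℤ.+ stepℤ b) bs

count : {A : Set} → (A → Bool) → List A → ℕ
count P [] = 0
count P (x ∷ xs) = ind (P x) ℕ.+ count P xs

module Submission where

-- The L rotations of a path of length L ending at height 1 are
-- distinct paths of the same kind.  Two of them have the form u ++ v and v ++ u;
-- as the heights of u and v add up to 1, one of the pieces, say u, ends at height
-- ≥ 1 and the other at height ≤ 0, and then v ++ u has more low steps of any kind
-- that v starts with than u ++ v.  So such a statistic separates the rotations; as
-- it takes values in 1..L, it takes each of them exactly once, and summing over all
-- rotations gives L · #{p : statistic k} = #P(n,1,1) = C(2n+1, n) for every k.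
-- Part (3) is this for vertices; parts (1) and (2) follow from one statistic that
-- ranks up-first paths 1..n+1 and down-first paths n+2..2n+1, together with the
-- absorption identity (k+1) C(m+1, k+1) = (m+1) C(m, k).

open import Defs
open import Algebra.Bundles using (AbelianGroup)
open import Data.Bool using (Bool; true; false; not; T; _∧_)
open import Data.Bool.Properties using (T-∧)
open import Data.Integer as ℤ using (ℤ; 0ℤ; 1ℤ; -1ℤ; _≤ᵇ_)
import Data.Integer.Properties as ℤP
open import Algebra.Properties.Group (AbelianGroup.group ℤP.+-0-abelianGroup)
  using () renaming (∙-cancelʳ to ℤ-+-cancelʳ)
open import Data.Integer.Tactic.RingSolver using (solve-∀)
open import Data.List using (List; []; _∷_; _++_; [_]; _∷ʳ_; map; length)
open import Data.List.Properties using (++-assoc; ++-identityʳ; length-++-comm)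
open import Data.List.Relation.Unary.All as All using (All; []; _∷_)
import Data.List.Relation.Unary.All.Properties as All
open import Data.Nat using (ℕ; zero; suc; _+_; _*_; _∸_; _≤_; _<_; s≤s; z≤n; _≡ᵇ_)
open import Data.Nat.Properties
open import Algebra.Properties.CommutativeSemigroup +-commutativeSemigroup
  using (interchange)
open import Algebra.Properties.CommutativeSemigroup *-commutativeSemigroup
  using (x∙yz≈y∙xz)
open import Data.Nat.Combinatorics using (_C_; nCk+nC[k+1]≡[n+1]C[k+1]; nCk≡nC[n∸k]; nC1≡n)
open import Data.Product using (_×_; _,_; proj₁; proj₂; ∃-syntax)
open import Data.Sum using (_⊎_; inj₁; inj₂)
open import Function using (id; _∘_; _⇔_; mk⇔; Equivalence)
open import Relation.Binary.PropositionalEquality hiding ([_])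
open import Relation.Nullary using (Dec; yes; no; does; contradiction)
open import Relation.Nullary.Decidable using (dec-true; dec-false; does-⇔)

private
  variable
    A : Set

count-++ : (P : A → Bool) (xs ys : List A) → count P (xs ++ ys) ≡ count P xs + count P ys
count-++ P []       ys = refl
count-++ P (x ∷ xs) ys =
  trans (cong (ind (P x) +_) (count-++ P xs ys)) (sym (+-assoc (ind (P x)) _ _))

count-map : {B : Set} (P : B → Bool) (f : A → B) (xs : List A) →
            count P (map f xs) ≡ count (P ∘ f) xs
count-map P f []       = refl
count-map P f (x ∷ xs) = cong (ind (P (f x)) +_) (count-map P f xs)

count-cong : {P Q : A → Bool} {xs : List A} →
             All (λ x → P x ≡ Q x) xs → count P xs ≡ count Q xs
count-cong []       = refl
count-cong (e ∷ es) = cong₂ _+_ (cong ind e) (count-cong es)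

count-const-false : (xs : List A) → count (λ _ → false) xs ≡ 0
count-const-false []       = refl
count-const-false (x ∷ xs) = count-const-false xs

allLists-length : ∀ m → All (λ p → length p ≡ m) (allLists m)
allLists-length zero    = refl ∷ []
allLists-length (suc m) =
  All.++⁺ (All.map⁺ (All.map (cong suc) (allLists-length m)))
          (All.map⁺ (All.map (cong suc) (allLists-length m)))

count-allLists-∷ : ∀ m (P : List Bool → Bool) → count P (allLists (suc m)) ≡
  count (P ∘ (true ∷_)) (allLists m) + count (P ∘ (false ∷_)) (allLists m)
count-allLists-∷ m P =
  trans (count-++ P (map (true ∷_) (allLists m)) (map (false ∷_) (allLists m)))
        (cong₂ _+_ (count-map P (true ∷_) (allLists m)) (count-map P (false ∷_) (allLists m)))

count-allLists-∷ʳ : ∀ m (P : List Bool → Bool) → count P (allLists (suc m)) ≡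
  count (P ∘ (_∷ʳ true)) (allLists m) + count (P ∘ (_∷ʳ false)) (allLists m)
count-allLists-∷ʳ zero    P = cong (_+ (ind (P [ false ]) + 0)) (sym (+-identityʳ (ind (P [ true ]))))
count-allLists-∷ʳ (suc m) P = begin
  count P (allLists (suc (suc m)))
    ≡⟨ count-allLists-∷ (suc m) P ⟩
  count (P ∘ (true ∷_)) (allLists (suc m)) + count (P ∘ (false ∷_)) (allLists (suc m))
    ≡⟨ cong₂ _+_ (count-allLists-∷ʳ m (P ∘ (true ∷_))) (count-allLists-∷ʳ m (P ∘ (false ∷_))) ⟩
  (t⋯t + t⋯f) + (f⋯t + f⋯f)
    ≡⟨ interchange t⋯t t⋯f f⋯t f⋯f ⟩
  (t⋯t + f⋯t) + (t⋯f + f⋯f)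
    ≡⟨ sym (cong₂ _+_ (count-allLists-∷ m (P ∘ (_∷ʳ true))) (count-allLists-∷ m (P ∘ (_∷ʳ false)))) ⟩
  count (P ∘ (_∷ʳ true)) (allLists (suc m)) + count (P ∘ (_∷ʳ false)) (allLists (suc m)) ∎
  where
  open ≡-Reasoning
  around : Bool → Bool → ℕ
  around b b′ = count (λ p → P (b ∷ p ∷ʳ b′)) (allLists m)
  t⋯t = around true true
  t⋯f = around true false
  f⋯t = around false true
  f⋯f = around false false

ups downs : List Bool → ℕ
ups   = count id
downs = count not

count-allLists-ups : ∀ m u → count (λ p → ups p ≡ᵇ u) (allLists m) ≡ m C u
count-allLists-ups zero    zero    = refl
count-allLists-ups zero    (suc u) = refl
count-allLists-ups (suc m) zero    =
  trans (count-allLists-∷ m _)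
        (cong₂ _+_ (count-const-false (allLists m)) (count-allLists-ups m zero))
count-allLists-ups (suc m) (suc u) =
  trans (count-allLists-∷ m _)
        (trans (cong₂ _+_ (count-allLists-ups m u) (count-allLists-ups m (suc u)))
               (nCk+nC[k+1]≡[n+1]C[k+1] m u))

-- Cyclic rotations

rotate : List A → List A
rotate []       = []
rotate (x ∷ xs) = xs ∷ʳ x

rotate^ : ℕ → List A → List A
rotate^ zero    xs = xs
rotate^ (suc k) xs = rotate^ k (rotate xs)

rotate^-+ : ∀ k l (xs : List A) → rotate^ (k + l) xs ≡ rotate^ l (rotate^ k xs)
rotate^-+ zero    l xs = refl
rotate^-+ (suc k) l xs = rotate^-+ k l (rotate xs)

rotate^-++ : (u v : List A) → rotate^ (length u) (u ++ v) ≡ v ++ u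
rotate^-++ []      v = sym (++-identityʳ v)
rotate^-++ (x ∷ u) v = begin
  rotate^ (length u) ((u ++ v) ∷ʳ x)  ≡⟨ cong (rotate^ (length u)) (++-assoc u v [ x ]) ⟩
  rotate^ (length u) (u ++ v ∷ʳ x)    ≡⟨ rotate^-++ u (v ∷ʳ x) ⟩
  (v ∷ʳ x) ++ u                       ≡⟨ ++-assoc v [ x ] u ⟩
  v ++ x ∷ u                          ∎
  where open ≡-Reasoning

length-rotate^ : ∀ k (xs : List A) → length (rotate^ k xs) ≡ length xs
length-rotate^ zero    xs       = refl
length-rotate^ (suc k) []       = length-rotate^ k []
length-rotate^ (suc k) (x ∷ xs) =
  trans (length-rotate^ k (xs ∷ʳ x)) (length-++-comm xs [ x ])

split-nonempty : ∀ k (xs : List A) → 0 < k → k < length xs →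
  ∃[ c ] ∃[ u ] ∃[ d ] ∃[ v ] xs ≡ c ∷ u ++ d ∷ v × length (c ∷ u) ≡ k
split-nonempty (suc zero)    (c ∷ d ∷ v) _ _ = c , [] , d , v , refl , refl
split-nonempty (suc zero)    (c ∷ [])    _ (s≤s ())
split-nonempty (suc (suc k)) (c ∷ xs)    _ (s≤s k<) with split-nonempty (suc k) xs (s≤s z≤n) k<
... | c′ , u , d , v , refl , len = c , c′ ∷ u , d , v , refl , cong suc len

rotate^-pair : ∀ i j (xs : List A) → i < j → j < length xs →
  ∃[ c ] ∃[ u ] ∃[ d ] ∃[ v ]
    rotate^ i xs ≡ c ∷ u ++ d ∷ v × rotate^ j xs ≡ d ∷ v ++ c ∷ u
rotate^-pair i j xs i<j j<len
  with split-nonempty (j ∸ i) (rotate^ i xs) (m<n⇒0<n∸m i<j)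
         (subst (j ∸ i <_) (sym (length-rotate^ i xs)) (≤-<-trans (m∸n≤m j i) j<len))
... | c , u , d , v , eq , len = c , u , d , v , eq , (begin
  rotate^ j xs                                  ≡⟨ cong (λ l → rotate^ l xs) (sym (m+[n∸m]≡n (<⇒≤ i<j))) ⟩
  rotate^ (i + (j ∸ i)) xs                      ≡⟨ rotate^-+ i (j ∸ i) xs ⟩
  rotate^ (j ∸ i) (rotate^ i xs)                ≡⟨ cong₂ rotate^ (sym len) eq ⟩
  rotate^ (length (c ∷ u)) (c ∷ u ++ d ∷ v)     ≡⟨ rotate^-++ (c ∷ u) (d ∷ v) ⟩
  d ∷ v ++ c ∷ u                                ∎)
  where open ≡-Reasoning

count-allLists-rotate : ∀ m (P : List Bool → Bool) →
                        count (P ∘ rotate) (allLists m) ≡ count P (allLists m)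
count-allLists-rotate zero    P = refl
count-allLists-rotate (suc m) P =
  trans (count-allLists-∷ m (P ∘ rotate)) (sym (count-allLists-∷ʳ m P))

count-allLists-rotate^ : ∀ k m (P : List Bool → Bool) →
                         count (P ∘ rotate^ k) (allLists m) ≡ count P (allLists m)
count-allLists-rotate^ zero    m P = refl
count-allLists-rotate^ (suc k) m P =
  trans (count-allLists-rotate m (P ∘ rotate^ k)) (count-allLists-rotate^ k m P)

height : List Bool → ℤ
height = endHeight 0ℤ

endHeight-+ : ∀ h k p → endHeight (h ℤ.+ k) p ≡ h ℤ.+ endHeight k p
endHeight-+ h k []      = refl
endHeight-+ h k (b ∷ p) =
  trans (cong (λ x → endHeight x p) (ℤP.+-assoc h k (stepℤ b))) (endHeight-+ h (k ℤ.+ stepℤ b) p)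

endHeight≡+height : ∀ h p → endHeight h p ≡ h ℤ.+ height p
endHeight≡+height h p =
  trans (cong (λ x → endHeight x p) (sym (ℤP.+-identityʳ h))) (endHeight-+ h 0ℤ p)

endHeight-++ : ∀ h u v → endHeight h (u ++ v) ≡ endHeight (endHeight h u) v
endHeight-++ h []      v = refl
endHeight-++ h (b ∷ u) v = endHeight-++ (h ℤ.+ stepℤ b) u v

height-++ : ∀ u v → height (u ++ v) ≡ height u ℤ.+ height v
height-++ u v = trans (endHeight-++ 0ℤ u v) (endHeight≡+height (height u) v)

height-++-comm : ∀ u v → height (u ++ v) ≡ height (v ++ u)
height-++-comm u v =
  trans (height-++ u v) (trans (ℤP.+-comm (height u) (height v)) (sym (height-++ v u)))

height-rotate^ : ∀ k p → height (rotate^ k p) ≡ height p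
height-rotate^ zero    p       = refl
height-rotate^ (suc k) []      = height-rotate^ k []
height-rotate^ (suc k) (b ∷ p) =
  trans (height-rotate^ k (p ∷ʳ b)) (height-++-comm p [ b ])

endHeight-+-downs : ∀ h p → endHeight h p ℤ.+ ℤ.+ downs p ≡ h ℤ.+ ℤ.+ ups p
endHeight-+-downs h []          = refl
endHeight-+-downs h (true ∷ p)  =
  trans (endHeight-+-downs (h ℤ.+ 1ℤ) p) (ℤP.+-assoc h 1ℤ (ℤ.+ ups p))
endHeight-+-downs h (false ∷ p) = begin
  E ℤ.+ (1ℤ ℤ.+ ℤ.+ downs p)           ≡⟨ regroup E (ℤ.+ downs p) ⟩
  (E ℤ.+ ℤ.+ downs p) ℤ.+ 1ℤ           ≡⟨ cong (ℤ._+ 1ℤ) (endHeight-+-downs (h ℤ.+ -1ℤ) p) ⟩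
  ((h ℤ.+ -1ℤ) ℤ.+ ℤ.+ ups p) ℤ.+ 1ℤ ≡⟨ cancel h (ℤ.+ ups p) ⟩
  h ℤ.+ ℤ.+ ups p                     ∎
  where
  open ≡-Reasoning
  E = endHeight (h ℤ.+ -1ℤ) p
  regroup : ∀ (x y : ℤ) → x ℤ.+ (1ℤ ℤ.+ y) ≡ (x ℤ.+ y) ℤ.+ 1ℤ
  regroup = solve-∀
  cancel : ∀ (x y : ℤ) → ((x ℤ.+ -1ℤ) ℤ.+ y) ℤ.+ 1ℤ ≡ x ℤ.+ y
  cancel = solve-∀

ups+downs≡length : ∀ p → ups p + downs p ≡ length p
ups+downs≡length []          = refl
ups+downs≡length (true ∷ p)  = cong suc (ups+downs≡length p)
ups+downs≡length (false ∷ p) =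
  trans (+-suc (ups p) (downs p)) (cong suc (ups+downs≡length p))

height≡1⇔ups≡1+downs : ∀ p → height p ≡ 1ℤ ⇔ ups p ≡ suc (downs p)
height≡1⇔ups≡1+downs p = mk⇔
  (λ h≡1 → ℤP.+-injective (sym (trans (cong (ℤ._+ ℤ.+ downs p) (sym h≡1)) (endHeight-+-downs 0ℤ p))))
  (λ u≡ → ℤ-+-cancelʳ (ℤ.+ downs p) (height p) 1ℤ
            (trans (endHeight-+-downs 0ℤ p) (cong ℤ.+_ u≡)))

1+n+n≡1+2*n : ∀ n → suc n + n ≡ suc (2 * n)
1+n+n≡1+2*n n = cong (λ x → suc (n + x)) (sym (+-identityʳ n))

module _ (n : ℕ) (p : List Bool) (len : length p ≡ suc (2 * n)) where

  private
    ups+downs : ups p + downs p ≡ suc (2 * n)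
    ups+downs = trans (ups+downs≡length p) len

  downs≡n : ups p ≡ suc n → downs p ≡ n
  downs≡n u≡ = +-cancelˡ-≡ (suc n) _ _ (trans (cong (_+ downs p) (sym u≡)) (trans ups+downs (sym (1+n+n≡1+2*n n))))

  ups≡1+n : height p ≡ 1ℤ → ups p ≡ suc n
  ups≡1+n h≡1 = trans u≡ (cong suc d≡n)
    where
    u≡ = Equivalence.to (height≡1⇔ups≡1+downs p) h≡1
    d≡n : downs p ≡ n
    d≡n = *-cancelˡ-≡ _ _ 2 (trans (cong (downs p +_) (+-identityʳ _))
            (suc-injective (trans (cong (_+ downs p) (sym u≡)) ups+downs)))

  height≡1⇔ups≡1+n : height p ≡ 1ℤ ⇔ ups p ≡ suc n
  height≡1⇔ups≡1+n = mk⇔ ups≡1+n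
    (λ u≡ → Equivalence.from (height≡1⇔ups≡1+downs p) (trans u≡ (cong suc (sym (downs≡n u≡)))))

count-endsAtOne : ∀ n → count endsAtOne (allLists (suc (2 * n))) ≡ suc (2 * n) C suc n
count-endsAtOne n =
  trans (count-cong {Q = λ p → ups p ≡ᵇ suc n} (All.map (λ {p} → endsAtOne≡ {p}) (allLists-length _)))
        (count-allLists-ups (suc (2 * n)) (suc n))
  where
  endsAtOne≡ : ∀ {p} → length p ≡ suc (2 * n) → endsAtOne p ≡ (ups p ≡ᵇ suc n)
  endsAtOne≡ {p} len = does-⇔ (height≡1⇔ups≡1+n n p len) (height p ℤ.≟ 1ℤ) (ups p ≟ suc n)

low : ℤ → Bool
low h = h ≤ᵇ 0ℤ

lowSteps : (Bool → Bool) → ℤ → List Bool → ℕ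
lowSteps w h []       = 0
lowSteps w h (b ∷ bs) = ind (w b ∧ low h) + lowSteps w (h ℤ.+ stepℤ b) bs

upsLow≡lowSteps : ∀ h p → upsLow h p ≡ lowSteps id h p
upsLow≡lowSteps h []          = refl
upsLow≡lowSteps h (true ∷ p)  = cong (ind (low h) +_) (upsLow≡lowSteps (h ℤ.+ 1ℤ) p)
upsLow≡lowSteps h (false ∷ p) = upsLow≡lowSteps (h ℤ.+ -1ℤ) p

downsLow≡lowSteps : ∀ h p → downsLow h p ≡ lowSteps not h p
downsLow≡lowSteps h []          = refl
downsLow≡lowSteps h (true ∷ p)  = downsLow≡lowSteps (h ℤ.+ 1ℤ) p
downsLow≡lowSteps h (false ∷ p) = cong (ind (low h) +_) (downsLow≡lowSteps (h ℤ.+ -1ℤ) p)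

vertsLow≡lowSteps : ∀ h p → vertsLow h p ≡ lowSteps (λ _ → true) h p + ind (low (endHeight h p))
vertsLow≡lowSteps h []      = refl
vertsLow≡lowSteps h (b ∷ p) =
  trans (cong (ind (low h) +_) (vertsLow≡lowSteps (h ℤ.+ stepℤ b) p)) (sym (+-assoc (ind (low h)) _ _))

lowSteps-++ : ∀ w h u v → lowSteps w h (u ++ v) ≡ lowSteps w h u + lowSteps w (endHeight h u) v
lowSteps-++ w h []      v = refl
lowSteps-++ w h (b ∷ u) v =
  trans (cong (ind (w b ∧ low h) +_) (lowSteps-++ w (h ℤ.+ stepℤ b) u v)) (sym (+-assoc (ind (w b ∧ low h)) _ _))

ind-mono : ∀ {x y} → (T x → T y) → ind x ≤ ind y
ind-mono {false}         _ = z≤n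
ind-mono {true}  {true}  _ = ≤-refl
ind-mono {true}  {false} f = contradiction (f _) λ ()

ind-∧ : ∀ x y → ind (x ∧ y) ≤ ind x
ind-∧ x y = ind-mono (λ t → proj₁ (Equivalence.to (T-∧ {x} {y}) t))

low-antitone : ∀ {h h′} → h ℤ.≤ h′ → T (low h′) → T (low h)
low-antitone h≤h′ = ℤP.≤⇒≤ᵇ ∘ ℤP.≤-trans h≤h′ ∘ ℤP.≤ᵇ⇒≤

low≡false : ∀ {h} → 1ℤ ℤ.≤ h → low h ≡ false
low≡false {h} 1≤h with low h in eq
... | false = refl
... | true  = contradiction (ℤP.≤-trans 1≤h (ℤP.≤ᵇ⇒≤ (subst T (sym eq) _))) λ { (ℤ.+≤+ ()) }

lowSteps-≤-count : ∀ w h p → lowSteps w h p ≤ count w p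
lowSteps-≤-count w h []      = z≤n
lowSteps-≤-count w h (b ∷ p) = +-mono-≤ (ind-∧ (w b) (low h)) (lowSteps-≤-count w (h ℤ.+ stepℤ b) p)

lowSteps-antitone : ∀ w {h h′} p → h ℤ.≤ h′ → lowSteps w h′ p ≤ lowSteps w h p
lowSteps-antitone w []      h≤h′ = z≤n
lowSteps-antitone w {h} {h′} (b ∷ p) h≤h′ =
  +-mono-≤ (ind-mono (∧-low-antitone (w b))) (lowSteps-antitone w p (ℤP.+-monoˡ-≤ (stepℤ b) h≤h′))
  where
  ∧-low-antitone : ∀ x → T (x ∧ low h′) → T (x ∧ low h)
  ∧-low-antitone true  = low-antitone h≤h′
  ∧-low-antitone false = λ ()

lowSteps-< : ∀ w {h} d p → 1ℤ ℤ.≤ h → w d ≡ true → lowSteps w h (d ∷ p) < lowSteps w 0ℤ (d ∷ p)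
lowSteps-< w {h} d p 1≤h wd rewrite wd | low≡false 1≤h =
  s≤s (lowSteps-antitone w p (ℤP.+-monoˡ-≤ (stepℤ d) (ℤP.≤-trans (ℤ.+≤+ z≤n) 1≤h)))

-- The step d starts at height ≥ 1 in the first path and at 0 in the second, and u
-- starts at height ≤ 0 in the second.
lowSteps-swap-< : ∀ w u d v → 1ℤ ℤ.≤ height u → height (d ∷ v) ℤ.≤ 0ℤ → w d ≡ true →
                  lowSteps w 0ℤ (u ++ d ∷ v) < lowSteps w 0ℤ (d ∷ v ++ u)
lowSteps-swap-< w u d v 1≤U V≤0 wd = begin-strict
  lowSteps w 0ℤ (u ++ d ∷ v)                         ≡⟨ lowSteps-++ w 0ℤ u (d ∷ v) ⟩
  lowSteps w 0ℤ u + lowSteps w (height u) (d ∷ v)    <⟨ +-monoʳ-< (lowSteps w 0ℤ u) (lowSteps-< w d v 1≤U wd) ⟩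
  lowSteps w 0ℤ u + lowSteps w 0ℤ (d ∷ v)            ≤⟨ +-monoˡ-≤ (lowSteps w 0ℤ (d ∷ v)) (lowSteps-antitone w u V≤0) ⟩
  lowSteps w (height (d ∷ v)) u + lowSteps w 0ℤ (d ∷ v) ≡⟨ +-comm (lowSteps w (height (d ∷ v)) u) _ ⟩
  lowSteps w 0ℤ (d ∷ v) + lowSteps w (height (d ∷ v)) u ≡⟨ sym (lowSteps-++ w 0ℤ (d ∷ v) u) ⟩
  lowSteps w 0ℤ (d ∷ v ++ u)                         ∎
  where open ≤-Reasoning

sum≡1-split : ∀ {x y} → x ℤ.+ y ≡ 1ℤ → (1ℤ ℤ.≤ x × y ℤ.≤ 0ℤ) ⊎ (x ℤ.≤ 0ℤ × 1ℤ ℤ.≤ y)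
sum≡1-split {x} {y} x+y≡1 = split (1ℤ ℤ.≤? x)
  where
  b≡[a+b]-a : ∀ (a b : ℤ) → b ≡ (a ℤ.+ b) ℤ.- a
  b≡[a+b]-a = solve-∀

  y≡1-x : y ≡ 1ℤ ℤ.- x
  y≡1-x = trans (b≡[a+b]-a x y) (cong (ℤ._- x) x+y≡1)

  split : Dec (1ℤ ℤ.≤ x) → (1ℤ ℤ.≤ x × y ℤ.≤ 0ℤ) ⊎ (x ℤ.≤ 0ℤ × 1ℤ ℤ.≤ y)
  split (yes 1≤x) = inj₁ (1≤x , subst (ℤ._≤ 0ℤ) (sym y≡1-x) (ℤP.i≤j⇒i-j≤0 1≤x))
  split (no  1≰x) = inj₂ (x≤0 , subst (1ℤ ℤ.≤_) (sym y≡1-x) (ℤP.+-monoʳ-≤ 1ℤ (ℤP.neg-mono-≤ x≤0)))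
    where
    x≤0 : x ℤ.≤ 0ℤ
    x≤0 = ℤP.i<j⇒i≤pred[j] (ℤP.≰⇒> 1≰x)

lowSteps-swap-≢ : ∀ w c u d v → height (c ∷ u ++ d ∷ v) ≡ 1ℤ → w c ≡ true → w d ≡ true →
                  lowSteps w 0ℤ (c ∷ u ++ d ∷ v) ≢ lowSteps w 0ℤ (d ∷ v ++ c ∷ u)
lowSteps-swap-≢ w c u d v h≡1 wc wd
  with sum≡1-split (trans (sym (height-++ (c ∷ u) (d ∷ v))) h≡1)
... | inj₁ (1≤U , V≤0) = <⇒≢ (lowSteps-swap-< w (c ∷ u) d v 1≤U V≤0 wd)
... | inj₂ (U≤0 , 1≤V) = >⇒≢ (lowSteps-swap-< w (d ∷ v) c u 1≤V U≤0 wc)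

-- Sums over an initial segment of ℕ

∑< : ℕ → (ℕ → ℕ) → ℕ
∑< zero    f = 0
∑< (suc k) f = f k + ∑< k f

syntax ∑< k (λ i → e) = ∑[ i < k ] e

∑<-cong : ∀ k {f g : ℕ → ℕ} → (∀ i → i < k → f i ≡ g i) → ∑< k f ≡ ∑< k g
∑<-cong zero    e = refl
∑<-cong (suc k) e = cong₂ _+_ (e k ≤-refl) (∑<-cong k (λ i i<k → e i (m<n⇒m<1+n i<k)))

∑<-mono-≤ : ∀ k {f g : ℕ → ℕ} → (∀ i → i < k → f i ≤ g i) → ∑< k f ≤ ∑< k g
∑<-mono-≤ zero    le = z≤n
∑<-mono-≤ (suc k) le = +-mono-≤ (le k ≤-refl) (∑<-mono-≤ k (λ i i<k → le i (m<n⇒m<1+n i<k)))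

∑<-const : ∀ k x → ∑[ i < k ] x ≡ k * x
∑<-const zero    x = refl
∑<-const (suc k) x = cong (x +_) (∑<-const k x)

∑<-zero : ∀ k {f : ℕ → ℕ} → (∀ i → i < k → f i ≡ 0) → ∑< k f ≡ 0
∑<-zero k e = trans (∑<-cong k e) (trans (∑<-const k 0) (*-zeroʳ k))

∑<-+ : ∀ k (f g : ℕ → ℕ) → ∑[ i < k ] (f i + g i) ≡ ∑< k f + ∑< k g
∑<-+ zero    f g = refl
∑<-+ (suc k) f g =
  trans (cong (f k + g k +_) (∑<-+ k f g)) (interchange (f k) (g k) (∑< k f) (∑< k g))

∑<-comm : ∀ k l (f : ℕ → ℕ → ℕ) → ∑[ i < k ] ∑[ j < l ] f i j ≡ ∑[ j < l ] ∑[ i < k ] f i j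
∑<-comm zero    l f = sym (∑<-zero l (λ _ _ → refl))
∑<-comm (suc k) l f = trans (cong (∑< l (f k) +_) (∑<-comm k l f)) (sym (∑<-+ l (f k) _))

∑<-count : ∀ k (Q : ℕ → A → Bool) (P : A → Bool) {xs : List A} →
           All (λ x → ∑[ i < k ] ind (Q i x) ≡ ind (P x)) xs →
           ∑[ i < k ] count (Q i) xs ≡ count P xs
∑<-count k Q P []       = ∑<-zero k (λ _ _ → refl)
∑<-count k Q P (e ∷ es) = trans (∑<-+ k _ _) (cong₂ _+_ e (∑<-count k Q P es))

∑<-≤1-tight : ∀ k {f : ℕ → ℕ} → (∀ i → i < k → f i ≤ 1) → ∑< k f ≡ k → ∀ i → i < k → f i ≡ 1
∑<-≤1-tight (suc k) {f} f≤1 sum≡ i i<1+k = at (m<1+n⇒m<n∨m≡n i<1+k)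
  where
  f≤1′ : ∀ j → j < k → f j ≤ 1
  f≤1′ j j<k = f≤1 j (m<n⇒m<1+n j<k)

  ∑≤k : ∑< k f ≤ k
  ∑≤k = subst (∑< k f ≤_) (trans (∑<-const k 1) (*-identityʳ k)) (∑<-mono-≤ k f≤1′)

  fk≡1 : f k ≡ 1
  fk≡1 = ≤-antisym (f≤1 k ≤-refl)
    (+-cancelʳ-≤ k 1 (f k) (subst (_≤ f k + k) sum≡ (+-monoʳ-≤ (f k) ∑≤k)))

  at : i < k ⊎ i ≡ k → f i ≡ 1
  at (inj₁ i<k) = ∑<-≤1-tight k f≤1′ (+-cancelˡ-≡ 1 _ _ (trans (cong (_+ ∑< k f) (sym fk≡1)) sum≡)) i i<k
  at (inj₂ refl) = fk≡1

ind-≡ᵇ-≡ : ∀ {x y} → x ≡ y → ind (x ≡ᵇ y) ≡ 1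
ind-≡ᵇ-≡ {x} {y} x≡y = cong ind (dec-true (x ≟ y) x≡y)

ind-≡ᵇ-≢ : ∀ {x y} → x ≢ y → ind (x ≡ᵇ y) ≡ 0
ind-≡ᵇ-≢ {x} {y} x≢y = cong ind (dec-false (x ≟ y) x≢y)

∑<-indicator : ∀ x k → 1 ≤ x → x ≤ k → ∑[ c < k ] ind (x ≡ᵇ suc c) ≡ 1
∑<-indicator x zero    1≤x x≤0 = contradiction (≤-trans 1≤x x≤0) λ ()
∑<-indicator x (suc k) 1≤x x≤1+k with x ≟ suc k
... | yes x≡1+k = cong₂ _+_ (ind-≡ᵇ-≡ x≡1+k) (∑<-zero k (λ c c<k →
        ind-≡ᵇ-≢ (λ x≡1+c → <⇒≢ (s≤s c<k) (trans (sym x≡1+c) x≡1+k))))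
... | no  x≢1+k = cong₂ _+_ (ind-≡ᵇ-≢ x≢1+k) (∑<-indicator x k 1≤x (≤-pred (≤∧≢⇒< x≤1+k x≢1+k)))

hits≤1 : ∀ L (t : ℕ → ℕ) c → (∀ i j → i < j → j < L → t i ≢ t j) →
         ∀ k → k ≤ L → ∑[ i < k ] ind (t i ≡ᵇ c) ≤ 1
hits≤1 L t c inj zero    _   = z≤n
hits≤1 L t c inj (suc k) k<L with t k ≟ c
... | yes tk≡c = ≤-reflexive (cong₂ _+_ (ind-≡ᵇ-≡ tk≡c) (∑<-zero k (λ i i<k →
        ind-≡ᵇ-≢ (λ ti≡c → inj i k i<k k<L (trans ti≡c (sym tk≡c))))))
... | no  tk≢c = subst (_≤ 1) (cong (_+ ∑[ i < k ] ind (t i ≡ᵇ c)) (sym (ind-≡ᵇ-≢ tk≢c))) (hits≤1 L t c inj k (<⇒≤ k<L))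

-- Double counting: the values t i are each hit by one c, so the per-value counts add
-- up to L, while injectivity bounds each of them by 1.
hits-once : ∀ L (t : ℕ → ℕ) → (∀ i → i < L → 1 ≤ t i × t i ≤ L) →
            (∀ i j → i < j → j < L → t i ≢ t j) →
            ∀ c → 1 ≤ c → c ≤ L → ∑[ i < L ] ind (t i ≡ᵇ c) ≡ 1
hits-once L t range inj (suc c) _ c<L =
  ∑<-≤1-tight L (λ c′ _ → hits≤1 L t (suc c′) inj L ≤-refl) total c c<L
  where
  total : ∑[ c′ < L ] ∑[ i < L ] ind (t i ≡ᵇ suc c′) ≡ L
  total = begin
    ∑[ c′ < L ] ∑[ i < L ] ind (t i ≡ᵇ suc c′)  ≡⟨ ∑<-comm L L (λ c′ i → ind (t i ≡ᵇ suc c′)) ⟩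
    ∑[ i < L ] ∑[ c′ < L ] ind (t i ≡ᵇ suc c′)  ≡⟨ ∑<-cong L (λ i i<L → ∑<-indicator (t i) L (proj₁ (range i i<L)) (proj₂ (range i i<L))) ⟩
    ∑[ i < L ] 1                                ≡⟨ trans (∑<-const L 1) (*-identityʳ L) ⟩
    L                                           ∎
    where open ≡-Reasoning

-- The cycle lemma

Path₁ : ℕ → List Bool → Set
Path₁ L p = length p ≡ L × height p ≡ 1ℤ

Path₁-rotate^ : ∀ {L p} k → Path₁ L p → Path₁ L (rotate^ k p)
Path₁-rotate^ {p = p} k (len , h≡1) = trans (length-rotate^ k p) len , trans (height-rotate^ k p) h≡1

Path₁-swap : ∀ {L} u v → Path₁ L (u ++ v) → Path₁ L (v ++ u)
Path₁-swap u v (len , h≡1) = trans (length-++-comm v u) len , trans (height-++-comm v u) h≡1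

endsAtOne⇒height≡1 : ∀ {p} → endsAtOne p ≡ true → height p ≡ 1ℤ
endsAtOne⇒height≡1 {p} e with height p ℤ.≟ 1ℤ
... | yes h≡1 = h≡1
endsAtOne⇒height≡1 () | no _

∧-congʳ-true : ∀ x {y z} → (x ≡ true → y ≡ z) → x ∧ y ≡ x ∧ z
∧-congʳ-true true  y≡z = y≡z refl
∧-congʳ-true false _   = refl

cycle-lemma : ∀ L (s : List Bool → ℕ) →
  (∀ p → Path₁ L p → 1 ≤ s p × s p ≤ L) →
  (∀ c u d v → Path₁ L (c ∷ u ++ d ∷ v) → s (c ∷ u ++ d ∷ v) ≢ s (d ∷ v ++ c ∷ u)) →
  ∀ k → 1 ≤ k → k ≤ L →
  L * count (λ p → endsAtOne p ∧ (s p ≡ᵇ k)) (allLists L) ≡ count endsAtOne (allLists L)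
cycle-lemma L s range separates k 1≤k k≤L = begin
  L * count P ps                       ≡⟨ sym (∑<-const L (count P ps)) ⟩
  ∑[ i < L ] count P ps                ≡⟨ ∑<-cong L (λ i _ → sym (count-allLists-rotate^ i L P)) ⟩
  ∑[ i < L ] count (P ∘ rotate^ i) ps  ≡⟨ ∑<-count L (λ i → P ∘ rotate^ i) endsAtOne (All.map orbit (allLists-length L)) ⟩
  count endsAtOne ps                   ∎
  where
  open ≡-Reasoning
  ps = allLists L

  P : List Bool → Bool
  P p = endsAtOne p ∧ (s p ≡ᵇ k)

  orbit : ∀ {p} → length p ≡ L → ∑[ i < L ] ind (P (rotate^ i p)) ≡ ind (endsAtOne p)
  orbit {p} len = trans (∑<-cong L (λ i _ → cong (λ b → ind (b ∧ (s (rotate^ i p) ≡ᵇ k))) (endsAtOne-rotate^ i)))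
                        (on-orbit (endsAtOne p) refl)
    where
    endsAtOne-rotate^ : ∀ i → endsAtOne (rotate^ i p) ≡ endsAtOne p
    endsAtOne-rotate^ i = cong (λ h → does (h ℤ.≟ 1ℤ)) (height-rotate^ i p)

    on-orbit : ∀ b → endsAtOne p ≡ b → ∑[ i < L ] ind (b ∧ (s (rotate^ i p) ≡ᵇ k)) ≡ ind b
    on-orbit false _ = ∑<-zero L (λ _ _ → refl)
    on-orbit true  e = hits-once L (λ i → s (rotate^ i p)) (λ i _ → range _ (Path₁-rotate^ i path)) injective k 1≤k k≤L
      where
      path : Path₁ L p
      path = len , endsAtOne⇒height≡1 {p} e

      injective : ∀ i j → i < j → j < L → s (rotate^ i p) ≢ s (rotate^ j p)
      injective i j i<j j<L with rotate^-pair i j p i<j (subst (j <_) (sym len) j<L)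
      ... | c , u , d , v , eqᵢ , eqⱼ rewrite eqᵢ | eqⱼ =
        separates c u d v (subst (Path₁ L) eqᵢ (Path₁-rotate^ i path))

count-const-true : (xs : List A) → count (λ _ → true) xs ≡ length xs
count-const-true []       = refl
count-const-true (x ∷ xs) = cong suc (count-const-true xs)

vertsLow-equidistributed : ∀ L k → 1 ≤ k → k ≤ L →
  L * count (λ p → endsAtOne p ∧ (vertsLow 0ℤ p ≡ᵇ k)) (allLists L) ≡ count endsAtOne (allLists L)
vertsLow-equidistributed L k 1≤k k≤L =
  trans (cong (L *_) (count-cong (All.universal agree (allLists L))))
        (cycle-lemma L lowVertices range separates k 1≤k k≤L)
  where
  lowVertices : List Bool → ℕ
  lowVertices = lowSteps (λ _ → true) 0ℤ

  agree : ∀ p → (endsAtOne p ∧ (vertsLow 0ℤ p ≡ᵇ k)) ≡ (endsAtOne p ∧ (lowVertices p ≡ᵇ k))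
  agree p = ∧-congʳ-true (endsAtOne p) λ e → cong (_≡ᵇ k) (begin
    vertsLow 0ℤ p                              ≡⟨ vertsLow≡lowSteps 0ℤ p ⟩
    lowVertices p + ind (low (height p))       ≡⟨ cong (λ h → lowVertices p + ind (low h)) (endsAtOne⇒height≡1 {p} e) ⟩
    lowVertices p + 0                          ≡⟨ +-identityʳ _ ⟩
    lowVertices p                              ∎)
    where open ≡-Reasoning

  range : ∀ p → Path₁ L p → 1 ≤ lowVertices p × lowVertices p ≤ L
  range (b ∷ p) (len , _) = s≤s z≤n ,
    subst (lowVertices (b ∷ p) ≤_) (trans (count-const-true (b ∷ p)) len) (lowSteps-≤-count _ 0ℤ (b ∷ p))

  separates : ∀ c u d v → Path₁ L (c ∷ u ++ d ∷ v) → lowVertices (c ∷ u ++ d ∷ v) ≢ lowVertices (d ∷ v ++ c ∷ u)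
  separates c u d v (_ , h≡1) = lowSteps-swap-≢ _ c u d v h≡1 refl refl

-- On P(n,1,1) up-first paths have rank in 1..n+1 and down-first paths rank in
-- n+2..2n+1, so the cycle lemma for the rank yields parts (1) and (2) at once.
rank : ℕ → List Bool → ℕ
rank n []          = 0
rank n (true ∷ p)  = lowSteps id 0ℤ (true ∷ p)
rank n (false ∷ p) = suc n + lowSteps not 0ℤ (false ∷ p)

rank-up-≤ : ∀ n p → ups (true ∷ p) ≡ suc n → rank n (true ∷ p) ≤ suc n
rank-up-≤ n p ups≡ = subst (rank n (true ∷ p) ≤_) ups≡ (lowSteps-≤-count id 0ℤ (true ∷ p))

rank-down-> : ∀ n p → suc n < rank n (false ∷ p)
rank-down-> n p = m<m+n (suc n) (s≤s z≤n)

rank-down-≤ : ∀ n p → downs (false ∷ p) ≡ n → rank n (false ∷ p) ≤ suc n + n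
rank-down-≤ n p downs≡ =
  +-monoʳ-≤ (suc n) (subst (lowSteps not 0ℤ (false ∷ p) ≤_) downs≡ (lowSteps-≤-count not 0ℤ (false ∷ p)))

rank-range : ∀ n p → Path₁ (suc (2 * n)) p → 1 ≤ rank n p × rank n p ≤ suc (2 * n)
rank-range n (true ∷ p)  (len , h≡1) =
  s≤s z≤n , ≤-trans (rank-up-≤ n p (ups≡1+n n (true ∷ p) len h≡1)) (s≤s (m≤m+n n _))
rank-range n (false ∷ p) (len , h≡1) =
  s≤s z≤n , ≤-trans (rank-down-≤ n p (downs≡n n (false ∷ p) len (ups≡1+n n (false ∷ p) len h≡1))) (≤-reflexive (1+n+n≡1+2*n n))

rank-separates : ∀ n c u d v → Path₁ (suc (2 * n)) (c ∷ u ++ d ∷ v) →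
                 rank n (c ∷ u ++ d ∷ v) ≢ rank n (d ∷ v ++ c ∷ u)
rank-separates n true  u true  v (_ , h≡1)   = lowSteps-swap-≢ id true u true v h≡1 refl refl
rank-separates n false u false v (_ , h≡1)   =
  lowSteps-swap-≢ not false u false v h≡1 refl refl ∘ +-cancelˡ-≡ (suc n) _ _
rank-separates n true  u false v (len , h≡1) =
  <⇒≢ (≤-<-trans (rank-up-≤ n (u ++ false ∷ v) (ups≡1+n n (true ∷ u ++ false ∷ v) len h≡1)) (rank-down-> n (v ++ true ∷ u)))
rank-separates n false u true  v path        =
  >⇒≢ (≤-<-trans (rank-up-≤ n (v ++ false ∷ u) (ups≡1+n n (true ∷ v ++ false ∷ u) len′ h≡1′)) (rank-down-> n (u ++ true ∷ v)))
  where
  swapped = Path₁-swap (false ∷ u) (true ∷ v) path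
  len′ = proj₁ swapped
  h≡1′ = proj₂ swapped

rank-equidistributed : ∀ n k → 1 ≤ k → k ≤ suc (2 * n) →
  suc (2 * n) * count (λ p → endsAtOne p ∧ (rank n p ≡ᵇ k)) (allLists (suc (2 * n)))
    ≡ count endsAtOne (allLists (suc (2 * n)))
rank-equidistributed n = cycle-lemma (suc (2 * n)) (rank n) (rank-range n) (rank-separates n)

startsUp-upsLow≡rank : ∀ n k p → 1 ≤ k → k ≤ suc n →
                       (startsUp p ∧ (upsLow 0ℤ p ≡ᵇ k)) ≡ (rank n p ≡ᵇ k)
startsUp-upsLow≡rank n zero    []          ()  _
startsUp-upsLow≡rank n (suc k) []          _   _   = refl
startsUp-upsLow≡rank n k       (true ∷ p)  _   _   = cong (_≡ᵇ k) (upsLow≡lowSteps 0ℤ (true ∷ p))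
startsUp-upsLow≡rank n k       (false ∷ p) _   k≤ =
  sym (dec-false (rank n (false ∷ p) ≟ k) (>⇒≢ (≤-<-trans k≤ (rank-down-> n p))))

startsDown-downsLow≡rank : ∀ n k p → 1 ≤ k → ups p ≡ suc n →
                           (startsDown p ∧ (downsLow 0ℤ p ≡ᵇ k)) ≡ (rank n p ≡ᵇ suc n + k)
startsDown-downsLow≡rank n k (true ∷ p)  1≤k ups≡ =
  sym (dec-false (rank n (true ∷ p) ≟ suc n + k) (<⇒≢ (≤-<-trans (rank-up-≤ n p ups≡) (m<m+n (suc n) 1≤k))))
startsDown-downsLow≡rank n k (false ∷ p) _   _    =
  trans (cong (_≡ᵇ k) (downsLow≡lowSteps 0ℤ (false ∷ p)))
        (does-⇔ (mk⇔ (cong (suc n +_)) (+-cancelˡ-≡ (suc n) _ _)) (_ ≟ k) (_ ≟ suc n + k))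

-- Binomial coefficients

[k+1]*[m+1]C[k+1]≡[m+1]*mCk : ∀ m k → suc k * (suc m C suc k) ≡ suc m * (m C k)
[k+1]*[m+1]C[k+1]≡[m+1]*mCk zero     zero     = refl
[k+1]*[m+1]C[k+1]≡[m+1]*mCk zero     (suc k)  = *-zeroʳ (suc (suc k))
[k+1]*[m+1]C[k+1]≡[m+1]*mCk (suc m)  zero     =
  trans (+-identityʳ _) (trans (nC1≡n (suc (suc m))) (sym (*-identityʳ (suc (suc m)))))
[k+1]*[m+1]C[k+1]≡[m+1]*mCk (suc m)  (suc k)  = begin
  suc (suc k) * (suc M C suc (suc k))  ≡⟨ cong (suc (suc k) *_) (sym (nCk+nC[k+1]≡[n+1]C[k+1] M (suc k))) ⟩
  suc (suc k) * (a + b)                ≡⟨ *-distribˡ-+ (suc (suc k)) a b ⟩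
  (a + suc k * a) + suc (suc k) * b    ≡⟨ cong₂ (λ x y → (a + x) + y) ([k+1]*[m+1]C[k+1]≡[m+1]*mCk m k)
                                                                     ([k+1]*[m+1]C[k+1]≡[m+1]*mCk m (suc k)) ⟩
  (a + M * (m C k)) + M * (m C suc k)  ≡⟨ +-assoc a _ _ ⟩
  a + (M * (m C k) + M * (m C suc k))  ≡⟨ cong (a +_) (sym (*-distribˡ-+ M (m C k) (m C suc k))) ⟩
  a + M * (m C k + m C suc k)          ≡⟨ cong (λ x → a + M * x) (nCk+nC[k+1]≡[n+1]C[k+1] m k) ⟩
  a + M * a                            ∎
  where
  open ≡-Reasoning
  M = suc m
  a = M C suc k
  b = M C suc (suc k)

absorption-cancel : ∀ m k c → suc m * c ≡ suc m C suc k → suc k * c ≡ m C k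
absorption-cancel m k c eq = *-cancelˡ-≡ _ _ (suc m) (begin
  suc m * (suc k * c)     ≡⟨ x∙yz≈y∙xz (suc m) (suc k) c ⟩
  suc k * (suc m * c)     ≡⟨ cong (suc k *_) eq ⟩
  suc k * (suc m C suc k) ≡⟨ [k+1]*[m+1]C[k+1]≡[m+1]*mCk m k ⟩
  suc m * (m C k)         ∎)
  where open ≡-Reasoning

[2n+1]C[n+1]≡[2n+1]Cn : ∀ n → suc (2 * n) C suc n ≡ suc (2 * n) C n
[2n+1]C[n+1]≡[2n+1]Cn n =
  trans (nCk≡nC[n∸k] (s≤s (m≤m+n n (n + 0))))
        (cong (suc (2 * n) C_) (trans (m+n∸m≡n n (n + 0)) (+-identityʳ n)))

upFirst-count : ∀ n k → 1 ≤ k → k ≤ n + 1 →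
  (n + 1) * count (λ p → endsAtOne p ∧ startsUp p ∧ (upsLow 0ℤ p ≡ᵇ k)) (allLists (suc (2 * n)))
    ≡ (2 * n) C n
upFirst-count n k 1≤k k≤n+1 =
  trans (cong₂ _*_ (+-comm n 1) (count-cong (All.universal agree (allLists (suc (2 * n))))))
        (absorption-cancel (2 * n) n _
          (trans (rank-equidistributed n k 1≤k (≤-trans k≤1+n (s≤s (m≤m+n n _)))) (count-endsAtOne n)))
  where
  k≤1+n : k ≤ suc n
  k≤1+n = subst (k ≤_) (+-comm n 1) k≤n+1

  agree : ∀ p → (endsAtOne p ∧ startsUp p ∧ (upsLow 0ℤ p ≡ᵇ k)) ≡ (endsAtOne p ∧ (rank n p ≡ᵇ k))
  agree p = cong (endsAtOne p ∧_) (startsUp-upsLow≡rank n k p 1≤k k≤1+n)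

downFirst-count : ∀ n k → 1 ≤ k → k ≤ n →
  n * count (λ p → endsAtOne p ∧ startsDown p ∧ (downsLow 0ℤ p ≡ᵇ k)) (allLists (suc (2 * n)))
    ≡ (2 * n) C (n ∸ 1)
downFirst-count zero       k 1≤k k≤0 = contradiction (≤-trans 1≤k k≤0) λ ()
downFirst-count n@(suc n′) k 1≤k k≤n = absorption-cancel (2 * n) n′ _ (begin
  suc (2 * n) * count (λ p → endsAtOne p ∧ startsDown p ∧ (downsLow 0ℤ p ≡ᵇ k)) ps
    ≡⟨ cong (suc (2 * n) *_) (count-cong (All.map (λ {p} → agree p) (allLists-length (suc (2 * n))))) ⟩
  suc (2 * n) * count (λ p → endsAtOne p ∧ (rank n p ≡ᵇ suc n + k)) ps
    ≡⟨ rank-equidistributed n (suc n + k) (s≤s z≤n) (≤-trans (+-monoʳ-≤ (suc n) k≤n) (≤-reflexive (1+n+n≡1+2*n n))) ⟩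
  count endsAtOne ps
    ≡⟨ count-endsAtOne n ⟩
  suc (2 * n) C suc n
    ≡⟨ [2n+1]C[n+1]≡[2n+1]Cn n ⟩
  suc (2 * n) C n ∎)
  where
  open ≡-Reasoning
  ps = allLists (suc (2 * n))

  agree : ∀ p → length p ≡ suc (2 * n) →
          (endsAtOne p ∧ startsDown p ∧ (downsLow 0ℤ p ≡ᵇ k)) ≡ (endsAtOne p ∧ (rank n p ≡ᵇ suc n + k))
  agree p len = ∧-congʳ-true (endsAtOne p) λ e →
    startsDown-downsLow≡rank n k p 1≤k (ups≡1+n n p len (endsAtOne⇒height≡1 {p} e))

lowVertices-count : ∀ n k → 1 ≤ k → k ≤ suc (2 * n) →
  suc (2 * n) * count (λ p → endsAtOne p ∧ (vertsLow 0ℤ p ≡ᵇ k)) (allLists (suc (2 * n)))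
    ≡ suc (2 * n) C n
lowVertices-count n k 1≤k k≤ =
  trans (vertsLow-equidistributed (suc (2 * n)) k 1≤k k≤)
        (trans (count-endsAtOne n) ([2n+1]C[n+1]≡[2n+1]Cn n))

theorem5 : (n : ℕ) → 1 ≤ n →
    ((k : ℕ) → 1 ≤ k → k ≤ n + 1 →
      (n + 1) * count (λ p → endsAtOne p ∧ startsUp p ∧ (upsLow 0ℤ p ≡ᵇ k)) (allLists (2 * n + 1))
        ≡ (2 * n) C n)
    × ((k : ℕ) → 1 ≤ k → k ≤ n →
      n * count (λ p → endsAtOne p ∧ startsDown p ∧ (downsLow 0ℤ p ≡ᵇ k)) (allLists (2 * n + 1))
        ≡ (2 * n) C (n ∸ 1))
    × ((k : ℕ) → 1 ≤ k → k ≤ 2 * n + 1 →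
      (2 * n + 1) * count (λ p → endsAtOne p ∧ (vertsLow 0ℤ p ≡ᵇ k)) (allLists (2 * n + 1))
        ≡ (2 * n + 1) C n)
theorem5 n _ rewrite +-comm (2 * n) 1 = upFirst-count n , downFirst-count n , lowVertices-count n
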